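{- Every groupoid is a category, that is, a local functional catoid.
   Context: A catoid $(C,\odot,s,t)$ is a set with $\odot:C\times C\to\mathcal P C$ and $s,t:C\to C$ such that, with $X\odot Y=\bigcup_{x\in X,y\in Y}x\odot y$: $x\odot(y\odot z)=(x\odot y)\odot z$, $x\odot y\ne\emptyset\Rightarrow t(x)=s(y)$, $s(x)\odot x=\{x\}$, $x\odot t(x)=\{x\}$. It is local if $t(x)=s(y)\Rightarrow x\odot y\neq\emptyset$, and functional if $x,x'\in y\odot z$ implies $x=x'$. A groupoid is a catoid with $(-)^-:C\to C$ such that $x\odot x^-=\{s(x)\}$ and $x^-\odot x=\{t(x)\}$ for all $x$. -}

module Defs where

open import Level using (Level; _⊔_; suc)
open import Data.Product using (Σ; ∃; ∃-syntax; _×_; _,_)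
open import Relation.Binary.PropositionalEquality using (_≡_)
open import Function.Bundles using (_⇔_)

-- Subsets of C are predicates  C → Set ℓ.  The multioperation
-- ⊙ : C × C → 𝒫 C is encoded by its membership relation:
--   Mem w x y  means  w ∈ x ⊙ y.

module _ {a ℓ : Level} {C : Set a} (Mem : C → C → C → Set ℓ) where
  -- w ∈ x ⊙ (y ⊙ z)
  InL : C → C → C → C → Set (a ⊔ ℓ)
  InL w x y z = ∃[ u ] (Mem u y z × Mem w x u)
  -- w ∈ (x ⊙ y) ⊙ z
  InR : C → C → C → C → Set (a ⊔ ℓ)
  InR w x y z = ∃[ v ] (Mem v x y × Mem w v z)

record Catoid (a ℓ : Level) : Set (suc (a ⊔ ℓ)) where
  field
    Carrier : Set a
    _∈_⊙_   : Carrier → Carrier → Carrier → Set ℓ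
    s t     : Carrier → Carrier
    assoc   : ∀ x y z w → InL _∈_⊙_ w x y z ⇔ InR _∈_⊙_ w x y z
    match   : ∀ x y → (∃[ w ] (w ∈ x ⊙ y)) → t x ≡ s y
    sl      : ∀ x w → (w ∈ s x ⊙ x) ⇔ (w ≡ x)
    tr      : ∀ x w → (w ∈ x ⊙ t x) ⇔ (w ≡ x)

module _ {a ℓ : Level} (K : Catoid a ℓ) where
  open Catoid K

  IsLocal : Set (a ⊔ ℓ)
  IsLocal = ∀ x y → t x ≡ s y → ∃[ w ] (w ∈ x ⊙ y)

  IsFunctional : Set (a ⊔ ℓ)
  IsFunctional = ∀ x x′ y z → x ∈ y ⊙ z → x′ ∈ y ⊙ z → x ≡ x′

  IsCategory : Set (a ⊔ ℓ)
  IsCategory = IsLocal × IsFunctional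

record Groupoid (a ℓ : Level) : Set (suc (a ⊔ ℓ)) where
  field
    catoid : Catoid a ℓ
  open Catoid catoid public
  field
    _⁻       : Carrier → Carrier
    inv-r    : ∀ x w → (w ∈ x ⊙ (x ⁻)) ⇔ (w ≡ s x)
    inv-l    : ∀ x w → (w ∈ (x ⁻) ⊙ x) ⇔ (w ≡ t x)

{-# OPTIONS --safe #-}
module Submission where

-- In a groupoid, t x ≡ s y puts y in t x ⊙ y = (x⁻ ⊙ x) ⊙ y = x⁻ ⊙ (x ⊙ y), so
-- some u ∈ x ⊙ y has y ∈ x⁻ ⊙ u; this gives locality.  Every w ∈ x ⊙ y then
-- lies in x ⊙ (x⁻ ⊙ u) = (x ⊙ x⁻) ⊙ u = s x ⊙ u = {u}, which gives functionality.

open import Defs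
open import Level using (Level)
open import Data.Product using (∃-syntax; _×_; _,_)
open import Relation.Binary.PropositionalEquality using (_≡_; refl; sym; trans; subst)
open import Function.Bundles using (Equivalence)
open Equivalence using (to; from)

module CatoidProperties {a ℓ : Level} (K : Catoid a ℓ) where
  open Catoid K

  ∈-s⊙-self : ∀ x → x ∈ s x ⊙ x
  ∈-s⊙-self x = from (sl x x) refl

  t∘s≡s : ∀ x → t (s x) ≡ s x
  t∘s≡s x = match (s x) x (x , ∈-s⊙-self x)

  ∈-s⊙⇒≡ : ∀ {w x y} → w ∈ s x ⊙ y → w ≡ y
  ∈-s⊙⇒≡ {w} {x} {y} w∈ = to (sl y w) (subst (λ c → w ∈ c ⊙ y) sx≡sy w∈)
    where
    sx≡sy : s x ≡ s y
    sx≡sy = trans (sym (t∘s≡s x)) (match (s x) y (w , w∈))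

module GroupoidProperties {a ℓ : Level} (G : Groupoid a ℓ) where
  open Groupoid G
  open CatoidProperties catoid

  ∃-⊙-divided : ∀ x y → t x ≡ s y → ∃[ u ] (u ∈ x ⊙ y × y ∈ x ⁻ ⊙ u)
  ∃-⊙-divided x y tx≡sy = from (assoc (x ⁻) x y y) (t x , tx∈x⁻⊙x , y∈tx⊙y)
    where
    tx∈x⁻⊙x : t x ∈ x ⁻ ⊙ x
    tx∈x⁻⊙x = from (inv-l x (t x)) refl
    y∈tx⊙y : y ∈ t x ⊙ y
    y∈tx⊙y = subst (λ c → y ∈ c ⊙ y) (sym tx≡sy) (∈-s⊙-self y)

  ∈-⊙-divided⇒≡ : ∀ {w x y u} → y ∈ x ⁻ ⊙ u → w ∈ x ⊙ y → w ≡ u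
  ∈-⊙-divided⇒≡ {w} {x} {y} {u} y∈x⁻⊙u w∈x⊙y
    with to (assoc x (x ⁻) u w) (y , y∈x⁻⊙u , w∈x⊙y)
  ... | v , v∈x⊙x⁻ , w∈v⊙u with to (inv-r x v) v∈x⊙x⁻
  ... | refl = ∈-s⊙⇒≡ w∈v⊙u

  isLocal : IsLocal catoid
  isLocal x y tx≡sy with ∃-⊙-divided x y tx≡sy
  ... | u , u∈x⊙y , _ = u , u∈x⊙y

  isFunctional : IsFunctional catoid
  isFunctional w w′ x y w∈x⊙y w′∈x⊙y
    with ∃-⊙-divided x y (match x y (w , w∈x⊙y))
  ... | u , _ , y∈x⁻⊙u =
    trans (∈-⊙-divided⇒≡ y∈x⁻⊙u w∈x⊙y) (sym (∈-⊙-divided⇒≡ y∈x⁻⊙u w′∈x⊙y))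

proposition3p3 : {a ℓ : Level} (G : Groupoid a ℓ) → IsCategory (Groupoid.catoid G)
proposition3p3 G = isLocal , isFunctional
  where open GroupoidProperties G
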